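{- Let $\Gamma=(V,H)$ be an oriented hypergraph with no vertex of degree zero, and let $i,j\in V$ be distinct vertices. (i) If $i$ and $j$ are duplicate, then the transposition $p=(i\ j)$ is an adjacency automorphism of $\Gamma$. (ii) If $i$ and $j$ are duplicate and $\deg(i)=\deg(j)$, then the transposition $p=(i\ j)$ is a Laplacian automorphism of $\Gamma$. (iii) If $i$ and $j$ are twin, then the transposition $p=(i\ j)$ is a hypergraph automorphism of $\Gamma$. Moreover, the converses of (i), (ii) and (iii) are not true in general.
   Context: An oriented hypergraph is a pair $\Gamma=(V,H)$ where $V=\{1,\dots,n\}$ is a finite set of vertices and $H$ is a set of hyperedges, each hyperedge being a pair $h=(h_{in},h_{out})$ of disjoint subsets of $V$; the vertices of $h$ are the elements of $h_{in}\cup h_{out}$. The degree $\deg(i)$ is the number of hyperedges containing $i$. $\deg^+(i,j)$ is the number of hyperedges in which $i,j$ both lie in $h_{in}$ or both lie in $h_{out}$, and $\deg^-(i,j)$ is the number of hyperedges in which one of $i,j$ lies in $h_{in}$ and the other in $h_{out}$. The adjacency matrix $A$ is the $n\times n$ matrix with $A_{ii}=0$ and $A_{ij}=\deg^-(i,j)-\deg^+(i,j)$ for $i\ne j$. Two distinct vertices $i,j$ are duplicate if $A_{ik}=A_{jk}$ for all $k\in V$ (equivalently the $i$th and $j$th rows of $A$ coincide). Two distinct vertices $i,j$ are twin if for every $h=(h_{in},h_{out})\in H$: $i\in h_{in}\iff j\in h_{in}$ and $i\in h_{out}\iff j\in h_{out}$. A hypergraph automorphism is a permutation $p$ of $V$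 with $(p(h_{in}),p(h_{out}))\in H$ for all $h\in H$. An adjacency automorphism is a permutation $p$ of $V$ with $A_{p(i)p(j)}=A_{ij}$ for all $i,j$. A Laplacian automorphism is an adjacency automorphism $p$ with $\deg(p(i))=\deg(i)$ for all $i$. -}

module Defs where

open import Data.Nat using (ℕ; zero; suc)
open import Data.Integer using (ℤ; +_; _-_)
open import Data.Bool using (Bool; true; false; if_then_else_; _∧_; _∨_)
open import Data.Product using (_×_; _,_; proj₁; proj₂)
open import Data.List using (List; []; _∷_)
open import Data.List.Membership.Propositional using (_∈_)
open import Data.List.Relation.Unary.Unique.Propositional using (Unique)
open import Data.Fin using (Fin; _≟_)
open import Data.Fin.Subset using (Subset; _∩_; ⊥; _∪_)
open import Data.Fin.Permutation using (Permutation′; _⟨$⟩ʳ_; _⟨$⟩ˡ_)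
open import Data.Vec using (lookup; tabulate)
open import Relation.Nullary using (does; ¬_)
open import Relation.Binary.PropositionalEquality using (_≡_)

Hyperedge : ℕ → Set
Hyperedge n = Subset n × Subset n

hin hout : ∀ {n} → Hyperedge n → Subset n
hin  = proj₁
hout = proj₂

record OrientedHypergraph (n : ℕ) : Set where
  field
    edges    : List (Hyperedge n)
    unique   : Unique edges
    disjoint : ∀ h → h ∈ edges → hin h ∩ hout h ≡ ⊥
open OrientedHypergraph public

countB : ∀ {A : Set} → (A → Bool) → List A → ℕ
countB P []       = zero
countB P (x ∷ xs) = if P x then suc (countB P xs) else countB P xs

module _ {n : ℕ} (Γ : OrientedHypergraph n) where

  deg : Fin n → ℕ
  deg i = countB (λ h → lookup (hin h ∪ hout h) i) (edges Γ)

  deg⁺ : Fin n → Fin n → ℕ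
  deg⁺ i j = countB (λ h → (lookup (hin h) i ∧ lookup (hin h) j)
                         ∨ (lookup (hout h) i ∧ lookup (hout h) j)) (edges Γ)

  deg⁻ : Fin n → Fin n → ℕ
  deg⁻ i j = countB (λ h → (lookup (hin h) i ∧ lookup (hout h) j)
                         ∨ (lookup (hout h) i ∧ lookup (hin h) j)) (edges Γ)

  Adj : Fin n → Fin n → ℤ
  Adj i j = if does (i ≟ j) then + 0 else (+ deg⁻ i j) - (+ deg⁺ i j)

  NoDegreeZero : Set
  NoDegreeZero = ∀ i → ¬ (deg i ≡ 0)

  Duplicate : Fin n → Fin n → Set
  Duplicate i j = ∀ k → Adj i k ≡ Adj j k

  Twin : Fin n → Fin n → Set
  Twin i j = ∀ h → h ∈ edges Γ →
    (lookup (hin h) i ≡ lookup (hin h) j) × (lookup (hout h) i ≡ lookup (hout h) j)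

  image : Permutation′ n → Subset n → Subset n
  image p S = tabulate (λ k → lookup S (p ⟨$⟩ˡ k))

  IsHypergraphAut : Permutation′ n → Set
  IsHypergraphAut p = ∀ h → h ∈ edges Γ → (image p (hin h) , image p (hout h)) ∈ edges Γ

  IsAdjacencyAut : Permutation′ n → Set
  IsAdjacencyAut p = ∀ i j → Adj (p ⟨$⟩ʳ i) (p ⟨$⟩ʳ j) ≡ Adj i j

  IsLaplacianAut : Permutation′ n → Set
  IsLaplacianAut p = IsAdjacencyAut p × (∀ i → deg (p ⟨$⟩ʳ i) ≡ deg i)

-- A transposition (i j) fixes every function f with f i ≡ f j.  Duplicate
-- vertices have equal rows of A, hence (A being symmetric) equal columns, so
-- swapping them fixes A entrywise; equal degrees add that deg is fixed; twin
-- vertices lie in the same parts of every hyperedge, so the swap maps each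
-- hyperedge to itself.  Two-vertex hypergraphs refute the converses.
module Submission where

open import Defs
open import Data.Nat using (ℕ; suc)
open import Data.Integer using (+_; _-_)
open import Data.Bool using (Bool; true; false; _∧_; _∨_)
open import Data.Bool.Properties using (∧-comm; ∨-comm)
open import Data.Product using (_×_; Σ; ∃; _,_; proj₁; proj₂)
open import Data.List using ([]; _∷_)
open import Data.List.Membership.Propositional using (_∈_)
open import Data.List.Relation.Unary.Any using (here; there)
open import Data.List.Relation.Unary.All using ([]; _∷_)
open import Data.List.Relation.Unary.AllPairs using ([]; _∷_)
open import Data.Fin using (Fin; zero; suc; _≟_)
open import Data.Fin.Subset using (Subset)
open import Data.Fin.Permutation using (transpose; _⟨$⟩ʳ_)
import Data.Fin.Permutation.Components as PC
open import Function using (_∘_)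
open import Data.Vec using ([]; _∷_; lookup)
open import Data.Vec.Properties using (tabulate∘lookup; tabulate-cong)
open import Data.Empty using (⊥-elim)
open import Relation.Nullary using (¬_; yes; no)
open import Relation.Binary.PropositionalEquality
  using (_≡_; _≢_; _≗_; refl; sym; trans; cong; cong₂; subst)

countB-cong : ∀ {A : Set} {P Q : A → Bool} → P ≗ Q → ∀ xs → countB P xs ≡ countB Q xs
countB-cong P≗Q []       = refl
countB-cong {Q = Q} P≗Q (x ∷ xs) rewrite P≗Q x with Q x
... | true  = cong suc (countB-cong P≗Q xs)
... | false = countB-cong P≗Q xs

f∘transpose≗f : ∀ {n} {A : Set} (f : Fin n → A) {i j : Fin n} →
                f i ≡ f j → f ∘ PC.transpose i j ≗ f
f∘transpose≗f f {i} {j} fi≡fj k with k ≟ i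
... | yes refl = sym fi≡fj
... | no _ with k ≟ j
...   | yes refl = fi≡fj
...   | no _     = refl

module _ {n : ℕ} (Γ : OrientedHypergraph n) where

  deg⁺-sym : ∀ a b → deg⁺ Γ a b ≡ deg⁺ Γ b a
  deg⁺-sym a b = countB-cong
    (λ h → cong₂ _∨_ (∧-comm (lookup (hin h) a) _) (∧-comm (lookup (hout h) a) _))
    (edges Γ)

  deg⁻-sym : ∀ a b → deg⁻ Γ a b ≡ deg⁻ Γ b a
  deg⁻-sym a b = countB-cong
    (λ h → trans (cong₂ _∨_ (∧-comm (lookup (hin h) a) _) (∧-comm (lookup (hout h) a) _))
                 (∨-comm (lookup (hout h) b ∧ lookup (hin h) a) _))
    (edges Γ)

  Adj-sym : ∀ a b → Adj Γ a b ≡ Adj Γ b a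
  Adj-sym a b with a ≟ b | b ≟ a
  ... | yes _    | yes _    = refl
  ... | yes refl | no b≢a   = ⊥-elim (b≢a refl)
  ... | no a≢b   | yes refl = ⊥-elim (a≢b refl)
  ... | no _     | no _     = cong₂ (λ x y → + x - + y) (deg⁻-sym a b) (deg⁺-sym a b)

  Duplicate⇒sameColumn : ∀ {i j} → Duplicate Γ i j → ∀ a → Adj Γ a i ≡ Adj Γ a j
  Duplicate⇒sameColumn {i} {j} dup a = trans (Adj-sym a i) (trans (dup a) (Adj-sym j a))

  Duplicate⇒adjacencyAut : ∀ i j → Duplicate Γ i j → IsAdjacencyAut Γ (transpose i j)
  Duplicate⇒adjacencyAut i j dup a b =
    trans (f∘transpose≗f (λ z → Adj Γ z (τ b)) (dup (τ b)) a)
          (f∘transpose≗f (Adj Γ a) (Duplicate⇒sameColumn dup a) b)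
    where
    τ : Fin n → Fin n
    τ = PC.transpose i j

  Duplicate⇒laplacianAut : ∀ i j → Duplicate Γ i j → deg Γ i ≡ deg Γ j →
                           IsLaplacianAut Γ (transpose i j)
  Duplicate⇒laplacianAut i j dup degᵢ≡degⱼ =
    Duplicate⇒adjacencyAut i j dup , f∘transpose≗f (deg Γ) degᵢ≡degⱼ

  image-transpose : ∀ {i j} (S : Subset n) → lookup S i ≡ lookup S j →
                    image Γ (transpose i j) S ≡ S
  -- image looks S up through the inverse permutation, transpose j i.
  image-transpose S Sᵢ≡Sⱼ =
    trans (tabulate-cong (f∘transpose≗f (lookup S) (sym Sᵢ≡Sⱼ))) (tabulate∘lookup S)

  Twin⇒hypergraphAut : ∀ i j → Twin Γ i j → IsHypergraphAut Γ (transpose i j)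
  Twin⇒hypergraphAut i j twin h h∈Γ = subst (_∈ edges Γ) (sym image≡h) h∈Γ
    where
    image≡h : (image Γ (transpose i j) (hin h) , image Γ (transpose i j) (hout h)) ≡ h
    image≡h = cong₂ _,_ (image-transpose (hin h)  (proj₁ (twin h h∈Γ)))
                        (image-transpose (hout h) (proj₂ (twin h h∈Γ)))

V₀ V₁ V₀₁ ∅ : Subset 2
V₀  = true  ∷ false ∷ []
V₁  = false ∷ true  ∷ []
V₀₁ = true  ∷ true  ∷ []
∅   = false ∷ false ∷ []

-- A has rows (0, -1) and (-1, 0), so the vertices are not duplicate, yet A is swap-invariant.
singleEdge : OrientedHypergraph 2
singleEdge = record
  { edges    = (V₀₁ , ∅) ∷ []
  ; unique   = [] ∷ []
  ; disjoint = λ { _ (here refl) → refl }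
  }

twoLoops : OrientedHypergraph 2
twoLoops = record
  { edges    = (V₀ , ∅) ∷ (V₁ , ∅) ∷ []
  ; unique   = ((λ ()) ∷ []) ∷ [] ∷ []
  ; disjoint = λ { _ (here refl) → refl ; _ (there (here refl)) → refl }
  }

singleEdge-noDegreeZero : NoDegreeZero singleEdge
singleEdge-noDegreeZero zero ()
singleEdge-noDegreeZero (suc zero) ()

twoLoops-noDegreeZero : NoDegreeZero twoLoops
twoLoops-noDegreeZero zero ()
twoLoops-noDegreeZero (suc zero) ()

0≢1 : zero ≢ suc {1} zero
0≢1 ()

singleEdge-laplacianAut : IsLaplacianAut singleEdge (transpose zero (suc zero))
singleEdge-laplacianAut = adjacencyAut , degreeAut
  where
  adjacencyAut : IsAdjacencyAut singleEdge (transpose zero (suc zero))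
  adjacencyAut zero       zero       = refl
  adjacencyAut zero       (suc zero) = refl
  adjacencyAut (suc zero) zero       = refl
  adjacencyAut (suc zero) (suc zero) = refl
  degreeAut : ∀ a → deg singleEdge (transpose zero (suc zero) ⟨$⟩ʳ a) ≡ deg singleEdge a
  degreeAut zero       = refl
  degreeAut (suc zero) = refl

singleEdge-¬duplicate : ¬ Duplicate singleEdge zero (suc zero)
singleEdge-¬duplicate dup with dup zero
... | ()

twoLoops-hypergraphAut : IsHypergraphAut twoLoops (transpose zero (suc zero))
twoLoops-hypergraphAut _ (here refl)         = there (here refl)
twoLoops-hypergraphAut _ (there (here refl)) = here refl

twoLoops-¬twin : ¬ Twin twoLoops zero (suc zero)
twoLoops-¬twin twin with proj₁ (twin _ (here refl))
... | ()

proposition2 : (∀ (n : ℕ) (Γ : OrientedHypergraph n) → NoDegreeZero Γ → (i j : Fin n) → i ≢ j →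
    (Duplicate Γ i j → IsAdjacencyAut Γ (transpose i j))
    × (Duplicate Γ i j → deg Γ i ≡ deg Γ j → IsLaplacianAut Γ (transpose i j))
    × (Twin Γ i j → IsHypergraphAut Γ (transpose i j)))
    × (∃ λ (n : ℕ) → Σ (OrientedHypergraph n) λ Γ → NoDegreeZero Γ × Σ (Fin n) λ i → Σ (Fin n) λ j →
    i ≢ j × IsAdjacencyAut Γ (transpose i j) × ¬ Duplicate Γ i j)
    × (∃ λ (n : ℕ) → Σ (OrientedHypergraph n) λ Γ → NoDegreeZero Γ × Σ (Fin n) λ i → Σ (Fin n) λ j →
    i ≢ j × IsLaplacianAut Γ (transpose i j) × ¬ (Duplicate Γ i j × deg Γ i ≡ deg Γ j))
    × (∃ λ (n : ℕ) → Σ (OrientedHypergraph n) λ Γ → NoDegreeZero Γ × Σ (Fin n) λ i → Σ (Fin n) λ j →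
    i ≢ j × IsHypergraphAut Γ (transpose i j) × ¬ Twin Γ i j)
proposition2 =
    (λ n Γ _ i j _ → Duplicate⇒adjacencyAut Γ i j
                   , Duplicate⇒laplacianAut Γ i j
                   , Twin⇒hypergraphAut Γ i j)
  , (2 , singleEdge , singleEdge-noDegreeZero , zero , suc zero , 0≢1
       , proj₁ singleEdge-laplacianAut , singleEdge-¬duplicate)
  , (2 , singleEdge , singleEdge-noDegreeZero , zero , suc zero , 0≢1
       , singleEdge-laplacianAut , λ (dup , _) → singleEdge-¬duplicate dup)
  , (2 , twoLoops , twoLoops-noDegreeZero , zero , suc zero , 0≢1
       , twoLoops-hypergraphAut , twoLoops-¬twin)
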